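{- Let $n \equiv 1$ or $5 \pmod 6$ with $n\ge 7$, and let $g$ be an integer. For $m\in\{n-6,n\}$ let $H^m_{g-1,g}$ be the graph whose vertices are the $3$-element subsets $\{x,y,z\}$ of $\mathbb{Z}_m$ with $x+y+z \equiv 3(g-1)$ or $x+y+z\equiv 3g \pmod m$, two vertices adjacent if they share exactly two elements. Then $H^{n-6}_{g-1,g}$ is isomorphic to a subgraph of $H^n_{g-1,g}$.
   Context: $H^m_{g-1,g}$ is the subgraph of the $2$-block intersection graph induced by the blocks $\{(x,0),(y,0),(z,0)\}$ (Step 1a blocks) of $\mathcal{S}_{g-1}\cup\mathcal{S}_g$ in Schreiber's construction over $\mathbb{Z}_m$. -}

module Defs where

open import Data.Nat as ℕ using (ℕ; _<_)
open import Data.Integer as ℤ using (ℤ; +_; _-_)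
open import Data.Integer.Divisibility using (_∣_)
open import Data.Fin using (Fin; toℕ; _≟_)
open import Data.Fin.Properties using ()
open import Data.List using (List; _∷_; []; filter; length)
open import Data.Product using (Σ; _×_; _,_; proj₁)
open import Data.Sum using (_⊎_)
open import Relation.Binary.PropositionalEquality using (_≡_)
open import Relation.Nullary using (Dec; yes; no)
open import Data.Bool using (Bool; true; false; _∨_)
open import Relation.Nullary.Decidable using (⌊_⌋)

_≡_[mod_] : ℤ → ℤ → ℕ → Set
a ≡ b [mod m ] = (+ m) ∣ (a - b)

-- A 3-element subset {x,y,z} of ℤ_m = Fin m, written uniquely as x < y < z.
Triple : ℕ → Set
Triple m = Fin m × Fin m × Fin m

elems : ∀ {m} → Triple m → List (Fin m)
elems (x , y , z) = x ∷ y ∷ z ∷ []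

tsum : ∀ {m} → Triple m → ℤ
tsum (x , y , z) = + (toℕ x ℕ.+ toℕ y ℕ.+ toℕ z)

Vertex : ℕ → ℤ → Set
Vertex m g = Σ (Triple m) λ t → IsVertex t
  where
  IsVertex : Triple m → Set
  IsVertex (x , y , z) =
    (toℕ x < toℕ y × toℕ y < toℕ z) ×
    ((tsum (x , y , z) ≡ (+ 3) ℤ.* (g - + 1) [mod m ]) ⊎
     (tsum (x , y , z) ≡ (+ 3) ℤ.* g [mod m ]))

memb : ∀ {m} → Fin m → Triple m → Bool
memb a (x , y , z) = ⌊ a ≟ x ⌋ ∨ (⌊ a ≟ y ⌋ ∨ ⌊ a ≟ z ⌋)

common : ∀ {m} → Triple m → Triple m → ℕ
common s t = length (filter (λ a → memb a t ≟b true) (elems s))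
  where
  open import Data.Bool.Properties using () renaming (_≟_ to _≟b_)

Adj : (m : ℕ) (g : ℤ) → Vertex m g → Vertex m g → Set
Adj m g u v = common (proj₁ u) (proj₁ v) ≡ 2

-- G = H^a is isomorphic to a subgraph of H^b: there is an injective vertex map
-- sending adjacent vertices to adjacent vertices (vertices are identified by
-- their underlying 3-subset).
IsoToSubgraph : (a : ℕ) (g : ℤ) (b : ℕ) → Set
IsoToSubgraph a g b =
  Σ (Vertex a g → Vertex b g) λ f →
    (∀ u v → proj₁ (f u) ≡ proj₁ (f v) → proj₁ u ≡ proj₁ v) ×
    (∀ u v → Adj a g u v → Adj b g (f u) (f v))

module Submission where

open import Defs
open import Data.Nat using (ℕ; _≤_; _∸_; _%_)
open import Data.Integer using (ℤ)
open import Data.Sum using (_⊎_)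
open import Relation.Binary.PropositionalEquality using (_≡_)

open import Algebra.Definitions using (Commutative; Associative)
open import Data.Bool using (Bool; true; false; _∨_)
import Data.Bool.Properties as Bool
open import Data.Empty using (⊥-elim)
open import Data.Fin as Fin using (Fin; toℕ; fromℕ<)
import Data.Fin.Properties as Fin
open import Data.Integer as ℤ using (+_; -[1+_])
import Data.Integer.DivMod as ℤ
import Data.Integer.Divisibility.Signed as ℤ
import Data.Integer.Properties as ℤ
import Data.Integer.Tactic.RingSolver as ℤ
open import Data.List using (_∷_; []; filter; length)
open import Data.Nat using (zero; suc; _+_; _*_; _/_; _<_; _⊓_; _⊔_; _<?_; z≤n; s≤s; NonZero)
open import Data.Nat.DivMod using (m≡m%n+[m/n]*n; [m+n]%n≡m%n)
import Data.Nat.Properties as ℕ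
import Data.Nat.Tactic.RingSolver as ℕ
open import Data.Product using (Σ; _×_; _,_; proj₁; proj₂)
open import Data.Product.Properties using (,-injectiveˡ; ,-injectiveʳ)
open import Data.Sum using (inj₁; inj₂)
open import Function using (_∘_)
open import Relation.Binary.Bundles using (Setoid)
open import Relation.Binary.Definitions using (tri<; tri≈; tri>)
import Relation.Binary.Reasoning.Setoid as SetoidReasoning
open import Relation.Binary.Structures using (IsEquivalence)
open import Relation.Binary.PropositionalEquality
  using (_≢_; refl; sym; trans; cong; cong₂; subst; subst₂; module ≡-Reasoning)
open import Relation.Nullary using (Dec; ¬_; yes; no)
open import Relation.Nullary.Decidable using (⌊_⌋)

-- Write each element of ℤ_N as 3u + c with c = g − 1; this is possible because
-- N ≡ ±1 (mod 6) makes 3 invertible. A 3-subset is then a vertex exactly when its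
-- u-coordinates sum to σ ∈ {0, 1} modulo N. For a vertex of H^{m} (m = n − 6),
-- lift its u-coordinates to integers in a window [θ, θ + m), choosing θ by a
-- discrete intermediate value argument so that the lifts sum to exactly 3m + σ;
-- adding 6 to each lift gives integers summing to 3n + σ, i.e. a vertex of H^{n}.
-- The lifts are rigid: in two such lifted triples, elements congruent modulo any
-- N ≥ m are equal, since a shift by a multiple of N would move a window by more
-- than the sums (which differ by at most 1) allow. Modulo m this shows that
-- adjacent vertices keep their two common elements, and modulo n that the map is
-- injective.

-- Triples up to permutation

infix 4 _↭₃_

_³ : Set → Set
A ³ = A × A × A

map₃ : {A B : Set} → (A → B) → A ³ → B ³
map₃ f (a , b , c) = f a , f b , f c

fold₃ : {A : Set} → (A → A → A) → A ³ → A
fold₃ _∙_ (a , b , c) = (a ∙ b) ∙ c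

data _↭₃_ {A : Set} : A ³ → A ³ → Set where
  ↭₃-refl   : ∀ {t} → t ↭₃ t
  ↭₃-swap₁₂ : ∀ {a b c} → (a , b , c) ↭₃ (b , a , c)
  ↭₃-swap₂₃ : ∀ {a b c} → (a , b , c) ↭₃ (a , c , b)
  ↭₃-trans  : ∀ {s t r} → s ↭₃ t → t ↭₃ r → s ↭₃ r

All₃ : {A : Set} → (A → Set) → A ³ → Set
All₃ P (a , b , c) = P a × P b × P c

Distinct₃ : {A : Set} → A ³ → Set
Distinct₃ (a , b , c) = a ≢ b × b ≢ c × a ≢ c

module _ {A : Set} where

  ↭₃-sym : {s t : A ³} → s ↭₃ t → t ↭₃ s
  ↭₃-sym ↭₃-refl        = ↭₃-refl
  ↭₃-sym ↭₃-swap₁₂      = ↭₃-swap₁₂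
  ↭₃-sym ↭₃-swap₂₃      = ↭₃-swap₂₃
  ↭₃-sym (↭₃-trans p q) = ↭₃-trans (↭₃-sym q) (↭₃-sym p)

  ↭₃-map : {B : Set} (f : A → B) {s t : A ³} → s ↭₃ t → map₃ f s ↭₃ map₃ f t
  ↭₃-map f ↭₃-refl        = ↭₃-refl
  ↭₃-map f ↭₃-swap₁₂      = ↭₃-swap₁₂
  ↭₃-map f ↭₃-swap₂₃      = ↭₃-swap₂₃
  ↭₃-map f (↭₃-trans p q) = ↭₃-trans (↭₃-map f p) (↭₃-map f q)

  ↭₃-map⁻¹ : {B : Set} (f : A → B) {t : A ³} {r : B ³} → map₃ f t ↭₃ r →
             Σ (A ³) λ t′ → t ↭₃ t′ × map₃ f t′ ≡ r
  ↭₃-map⁻¹ f {t}         ↭₃-refl   = t , ↭₃-refl , refl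
  ↭₃-map⁻¹ f {a , b , c} ↭₃-swap₁₂ = (b , a , c) , ↭₃-swap₁₂ , refl
  ↭₃-map⁻¹ f {a , b , c} ↭₃-swap₂₃ = (a , c , b) , ↭₃-swap₂₃ , refl
  ↭₃-map⁻¹ f (↭₃-trans p q) with ↭₃-map⁻¹ f p
  ... | t₁ , t↭t₁ , refl with ↭₃-map⁻¹ f q
  ...   | t₂ , t₁↭t₂ , e = t₂ , ↭₃-trans t↭t₁ t₁↭t₂ , e

  ↭₃-invariant : {B : Set} (Φ : A ³ → B) →
    (∀ a b c → Φ (a , b , c) ≡ Φ (b , a , c)) →
    (∀ a b c → Φ (a , b , c) ≡ Φ (a , c , b)) →
    ∀ {s t} → s ↭₃ t → Φ s ≡ Φ t
  ↭₃-invariant Φ h₁₂ h₂₃ ↭₃-refl                     = refl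
  ↭₃-invariant Φ h₁₂ h₂₃ (↭₃-swap₁₂ {a} {b} {c})     = h₁₂ a b c
  ↭₃-invariant Φ h₁₂ h₂₃ (↭₃-swap₂₃ {a} {b} {c})     = h₂₃ a b c
  ↭₃-invariant Φ h₁₂ h₂₃ (↭₃-trans p q) =
    trans (↭₃-invariant Φ h₁₂ h₂₃ p) (↭₃-invariant Φ h₁₂ h₂₃ q)

  fold₃-↭₃ : {_∙_ : A → A → A} → Commutative _≡_ _∙_ → Associative _≡_ _∙_ →
             ∀ {s t} → s ↭₃ t → fold₃ _∙_ s ≡ fold₃ _∙_ t
  fold₃-↭₃ {_∙_} comm assoc = ↭₃-invariant (fold₃ _∙_)
    (λ a b c → cong (_∙ c) (comm a b))
    (λ a b c → begin
      (a ∙ b) ∙ c ≡⟨ assoc a b c ⟩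
      a ∙ (b ∙ c) ≡⟨ cong (a ∙_) (comm b c) ⟩
      a ∙ (c ∙ b) ≡⟨ assoc a c b ⟨
      (a ∙ c) ∙ b ∎)
    where open ≡-Reasoning

  Distinct₃-↭₃ : {s t : A ³} → s ↭₃ t → Distinct₃ s → Distinct₃ t
  Distinct₃-↭₃ ↭₃-refl        d              = d
  Distinct₃-↭₃ ↭₃-swap₁₂      (ab , bc , ac) = ab ∘ sym , ac , bc
  Distinct₃-↭₃ ↭₃-swap₂₃      (ab , bc , ac) = ac , bc ∘ sym , ab
  Distinct₃-↭₃ (↭₃-trans p q) d              = Distinct₃-↭₃ q (Distinct₃-↭₃ p d)

  Distinct₃-map : {B : Set} {f : A → B} → (∀ {x y} → f x ≡ f y → x ≡ y) →
                  ∀ t → Distinct₃ t → Distinct₃ (map₃ f t)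
  Distinct₃-map inj (a , b , c) (ab , bc , ac) = ab ∘ inj , bc ∘ inj , ac ∘ inj

  map₃-cong : {B : Set} {f g : A → B} → (∀ a → f a ≡ g a) → ∀ t → map₃ f t ≡ map₃ g t
  map₃-cong f≗g (a , b , c) = cong₂ _,_ (f≗g a) (cong₂ _,_ (f≗g b) (f≗g c))

  map₃-injective : {B : Set} {f : A → B} → (∀ {x y} → f x ≡ f y → x ≡ y) →
                   ∀ {s t} → map₃ f s ≡ map₃ f t → s ≡ t
  map₃-injective inj {_ , _ , _} {_ , _ , _} e =
    cong₂ _,_ (inj (,-injectiveˡ e))
      (cong₂ _,_ (inj (,-injectiveˡ (,-injectiveʳ e))) (inj (,-injectiveʳ (,-injectiveʳ e))))

sum₃ : ℕ ³ → ℕ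
sum₃ = fold₃ _+_

sum₃-↭₃ : {s t : ℕ ³} → s ↭₃ t → sum₃ s ≡ sum₃ t
sum₃-↭₃ = fold₃-↭₃ ℕ.+-comm ℕ.+-assoc

Ascending : ℕ ³ → Set
Ascending (a , b , c) = a < b × b < c

ascending-↭₃-unique : {s t : ℕ ³} → Ascending s → Ascending t → s ↭₃ t → s ≡ t
ascending-↭₃-unique {a , b , c} {a′ , b′ , c′} s↑ t↑ p = cong₂ _,_ a≡a′ (cong₂ _,_ b≡b′ c≡c′)
  where
  min₃-ascending : ∀ {x y z} → Ascending (x , y , z) → fold₃ _⊓_ (x , y , z) ≡ x
  min₃-ascending {x} (x<y , y<z) = trans (cong (_⊓ _) (ℕ.m≤n⇒m⊓n≡m (ℕ.<⇒≤ x<y)))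
                                         (ℕ.m≤n⇒m⊓n≡m (ℕ.<⇒≤ (ℕ.<-trans x<y y<z)))
  max₃-ascending : ∀ {x y z} → Ascending (x , y , z) → fold₃ _⊔_ (x , y , z) ≡ z
  max₃-ascending (x<y , y<z) = trans (cong (_⊔ _) (ℕ.m≤n⇒m⊔n≡n (ℕ.<⇒≤ x<y)))
                                     (ℕ.m≤n⇒m⊔n≡n (ℕ.<⇒≤ y<z))
  a≡a′ : a ≡ a′
  a≡a′ = trans (sym (min₃-ascending s↑))
           (trans (fold₃-↭₃ ℕ.⊓-comm ℕ.⊓-assoc p) (min₃-ascending t↑))
  c≡c′ : c ≡ c′
  c≡c′ = trans (sym (max₃-ascending s↑))
           (trans (fold₃-↭₃ ℕ.⊔-comm ℕ.⊔-assoc p) (max₃-ascending t↑))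
  b≡b′ : b ≡ b′
  b≡b′ = ℕ.+-cancelˡ-≡ a′ b b′ (ℕ.+-cancelʳ-≡ c′ (a′ + b) (a′ + b′)
           (subst (λ x → x + b + c′ ≡ a′ + b′ + c′) a≡a′
             (subst (λ z → a + b + z ≡ a′ + b′ + c′) c≡c′ (sum₃-↭₃ p))))

-- Blocks: membership and the number of common elements

⌊⌋-yes : {P : Set} (d : Dec P) → P → ⌊ d ⌋ ≡ true
⌊⌋-yes (yes _) _ = refl
⌊⌋-yes (no ¬p) p = ⊥-elim (¬p p)

⌊⌋-no : {P : Set} (d : Dec P) → ¬ P → ⌊ d ⌋ ≡ false
⌊⌋-no (yes p) ¬p = ⊥-elim (¬p p)
⌊⌋-no (no _)  _  = refl

indicator : Bool → ℕ
indicator true  = 1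
indicator false = 0

module _ {m : ℕ} where

  sort₃ : (t : Fin m ³) → Distinct₃ t → Σ (Fin m ³) λ s → Ascending (map₃ toℕ s) × t ↭₃ s
  sort₃ (a , b , c) (a≢b , b≢c , a≢c) with ℕ.<-cmp (toℕ a) (toℕ b)
  ... | tri≈ _ e _ = ⊥-elim (a≢b (Fin.toℕ-injective e))
  ... | tri< a<b _ _ with ℕ.<-cmp (toℕ b) (toℕ c)
  ...   | tri≈ _ e _ = ⊥-elim (b≢c (Fin.toℕ-injective e))
  ...   | tri< b<c _ _ = (a , b , c) , (a<b , b<c) , ↭₃-refl
  ...   | tri> _ _ c<b with ℕ.<-cmp (toℕ a) (toℕ c)
  ...     | tri≈ _ e _ = ⊥-elim (a≢c (Fin.toℕ-injective e))
  ...     | tri< a<c _ _ = (a , c , b) , (a<c , c<b) , ↭₃-swap₂₃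
  ...     | tri> _ _ c<a = (c , a , b) , (c<a , a<b) , ↭₃-trans ↭₃-swap₂₃ ↭₃-swap₁₂
  sort₃ (a , b , c) (a≢b , b≢c , a≢c) | tri> _ _ b<a with ℕ.<-cmp (toℕ a) (toℕ c)
  ... | tri≈ _ e _ = ⊥-elim (a≢c (Fin.toℕ-injective e))
  ... | tri< a<c _ _ = (b , a , c) , (b<a , a<c) , ↭₃-swap₁₂
  ... | tri> _ _ c<a with ℕ.<-cmp (toℕ b) (toℕ c)
  ...   | tri≈ _ e _ = ⊥-elim (b≢c (Fin.toℕ-injective e))
  ...   | tri< b<c _ _ = (b , c , a) , (b<c , c<a) , ↭₃-trans ↭₃-swap₁₂ ↭₃-swap₂₃
  ...   | tri> _ _ c<b = (c , b , a) , (c<b , b<a) ,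
                         ↭₃-trans ↭₃-swap₁₂ (↭₃-trans ↭₃-swap₂₃ ↭₃-swap₁₂)

  ascending⇒distinct : ∀ {t : Fin m ³} → Ascending (map₃ toℕ t) → Distinct₃ t
  ascending⇒distinct (x<y , y<z) =
    (λ e → ℕ.<-irrefl (cong toℕ e) x<y) , (λ e → ℕ.<-irrefl (cong toℕ e) y<z) ,
    (λ e → ℕ.<-irrefl (cong toℕ e) (ℕ.<-trans x<y y<z))

  ascending-unique : {s t : Fin m ³} → Ascending (map₃ toℕ s) → Ascending (map₃ toℕ t) →
                     s ↭₃ t → s ≡ t
  ascending-unique s↑ t↑ p =
    map₃-injective Fin.toℕ-injective (ascending-↭₃-unique s↑ t↑ (↭₃-map toℕ p))

  memb-sound : ∀ {a : Fin m} x y z → memb a (x , y , z) ≡ true → a ≡ x ⊎ a ≡ y ⊎ a ≡ z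
  memb-sound {a} x y z h with a Fin.≟ x
  ... | yes e = inj₁ e
  ... | no _ with a Fin.≟ y
  ...   | yes e = inj₂ (inj₁ e)
  ...   | no _ with a Fin.≟ z
  ...     | yes e = inj₂ (inj₂ e)
  memb-sound x y z () | no _ | no _ | no _

  memb-complete : ∀ {a : Fin m} x y z → a ≡ x ⊎ a ≡ y ⊎ a ≡ z → memb a (x , y , z) ≡ true
  memb-complete {a} x y z (inj₁ e)        = cong (_∨ _) (⌊⌋-yes (a Fin.≟ x) e)
  memb-complete {a} x y z (inj₂ (inj₁ e)) =
    trans (cong (λ q → ⌊ a Fin.≟ x ⌋ ∨ (q ∨ _)) (⌊⌋-yes (a Fin.≟ y) e)) (Bool.∨-zeroʳ _)
  memb-complete {a} x y z (inj₂ (inj₂ e)) =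
    trans (cong (λ r → ⌊ a Fin.≟ x ⌋ ∨ (⌊ a Fin.≟ y ⌋ ∨ r)) (⌊⌋-yes (a Fin.≟ z) e))
          (trans (cong (⌊ a Fin.≟ x ⌋ ∨_) (Bool.∨-zeroʳ _)) (Bool.∨-zeroʳ _))

  memb-absent : ∀ {a : Fin m} x y z → a ≢ x → a ≢ y → a ≢ z → memb a (x , y , z) ≡ false
  memb-absent {a} x y z a≢x a≢y a≢z
    rewrite ⌊⌋-no (a Fin.≟ x) a≢x | ⌊⌋-no (a Fin.≟ y) a≢y | ⌊⌋-no (a Fin.≟ z) a≢z = refl

  memb-↭₃ : ∀ (a : Fin m) {s t} → s ↭₃ t → memb a s ≡ memb a t
  memb-↭₃ a {s} {t} p = begin
    memb a s                ≡⟨ memb-fold s ⟩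
    fold₃ _∨_ (map₃ is-a s) ≡⟨ fold₃-↭₃ Bool.∨-comm Bool.∨-assoc (↭₃-map is-a p) ⟩
    fold₃ _∨_ (map₃ is-a t) ≡⟨ memb-fold t ⟨
    memb a t                ∎
    where
    open ≡-Reasoning
    is-a : Fin m → Bool
    is-a x = ⌊ a Fin.≟ x ⌋
    memb-fold : ∀ t → memb a t ≡ fold₃ _∨_ (map₃ is-a t)
    memb-fold (x , y , z) = sym (Bool.∨-assoc ⌊ a Fin.≟ x ⌋ ⌊ a Fin.≟ y ⌋ ⌊ a Fin.≟ z ⌋)

  memb⇒↭₃-front : ∀ {a : Fin m} t → memb a t ≡ true →
                  Σ (Fin m) λ r₁ → Σ (Fin m) λ r₂ → t ↭₃ (a , r₁ , r₂)
  memb⇒↭₃-front {a} (x , y , z) h with memb-sound {a} x y z h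
  ... | inj₁ refl        = y , z , ↭₃-refl
  ... | inj₂ (inj₁ refl) = x , z , ↭₃-swap₁₂
  ... | inj₂ (inj₂ refl) = x , y , ↭₃-trans ↭₃-swap₂₃ ↭₃-swap₁₂

  memb₂⇒↭₃-front : ∀ {a b : Fin m} t → a ≢ b → memb a t ≡ true → memb b t ≡ true →
                   Σ (Fin m) λ c → t ↭₃ (a , b , c)
  memb₂⇒↭₃-front {a} {b} t a≢b a∈t b∈t with memb⇒↭₃-front t a∈t
  ... | r₁ , r₂ , p with memb-sound a r₁ r₂ (trans (sym (memb-↭₃ b p)) b∈t)
  ...   | inj₁ e           = ⊥-elim (a≢b (sym e))
  ...   | inj₂ (inj₁ refl) = r₂ , p
  ...   | inj₂ (inj₂ refl) = r₁ , ↭₃-trans p ↭₃-swap₂₃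

  common-count : ∀ s t → common s t ≡ sum₃ (map₃ (λ a → indicator (memb a t)) s)
  common-count (x , y , z) t = begin
    common (x , y , z) t                     ≡⟨ length-filter-∷ x _ ⟩
    ι x + length (filter P? (y ∷ z ∷ []))   ≡⟨ cong (λ k → ι x + k) (length-filter-∷ y _) ⟩
    ι x + (ι y + length (filter P? (z ∷ []))) ≡⟨ cong (λ k → ι x + (ι y + k)) (length-filter-∷ z _) ⟩
    ι x + (ι y + (ι z + 0))                  ≡⟨ cong (λ k → ι x + (ι y + k)) (ℕ.+-identityʳ (ι z)) ⟩
    ι x + (ι y + ι z)                        ≡⟨ ℕ.+-assoc (ι x) (ι y) (ι z) ⟨
    ι x + ι y + ι z                          ∎
    where
    open ≡-Reasoning
    ι : Fin m → ℕ
    ι a = indicator (memb a t)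
    P? = λ a → memb a t Bool.≟ true
    length-filter-∷ : ∀ a as → length (filter P? (a ∷ as)) ≡ ι a + length (filter P? as)
    length-filter-∷ a as with memb a t
    ... | true  = refl
    ... | false = refl

  common-↭₃ˡ : ∀ {s s′} t → s ↭₃ s′ → common s t ≡ common s′ t
  common-↭₃ˡ {s} {s′} t p = trans (common-count s t)
    (trans (sum₃-↭₃ (↭₃-map (λ a → indicator (memb a t)) p)) (sym (common-count s′ t)))

  common-↭₃ʳ : ∀ s {t t′} → t ↭₃ t′ → common s t ≡ common s t′
  common-↭₃ʳ s {t} {t′} p = trans (common-count s t)
    (trans (cong sum₃ (map₃-cong (λ a → cong indicator (memb-↭₃ a p)) s)) (sym (common-count s t′)))

  common-two : ∀ (a b c c′ : Fin m) → c ≢ a → c ≢ b → c ≢ c′ → common (a , b , c) (a , b , c′) ≡ 2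
  common-two a b c c′ c≢a c≢b c≢c′ rewrite common-count (a , b , c) (a , b , c′)
    | memb-complete a b c′ (inj₁ refl) | memb-complete {b} a b c′ (inj₂ (inj₁ refl))
    | memb-absent a b c′ c≢a c≢b c≢c′ = refl

  record SharedPair (s t : Fin m ³) : Set where
    field
      a b d d′ : Fin m
      s↭ : s ↭₃ (a , b , d)
      t↭ : t ↭₃ (a , b , d′)
      d≢d′ : d ≢ d′

  sharedPair : ∀ {s t} a b c → s ↭₃ (a , b , c) → a ≢ b →
               memb a t ≡ true → memb b t ≡ true → memb c t ≡ false → SharedPair s t
  sharedPair {t = t} a b c p a≢b a∈ b∈ c∉ with memb₂⇒↭₃-front t a≢b a∈ b∈
  ... | c′ , q = record { a = a ; b = b ; d = c ; d′ = c′ ; s↭ = p ; t↭ = q ; d≢d′ = c≢c′ }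
    where
    c≢c′ : c ≢ c′
    c≢c′ refl with trans (sym (memb-complete a b c (inj₂ (inj₂ refl)))) (trans (sym (memb-↭₃ c q)) c∉)
    ... | ()

  common≡2⇒SharedPair : ∀ s t → Distinct₃ s → common s t ≡ 2 → SharedPair s t
  common≡2⇒SharedPair (x , y , z) t (x≢y , y≢z , x≢z) h
    with memb x t in x∈ | memb y t in y∈ | memb z t in z∈ | trans (sym (common-count (x , y , z) t)) h
  ... | true  | true  | false | _ = sharedPair x y z ↭₃-refl x≢y x∈ y∈ z∈
  ... | true  | false | true  | _ = sharedPair x z y ↭₃-swap₂₃ x≢z x∈ z∈ y∈
  ... | false | true  | true  | _ = sharedPair y z x (↭₃-trans ↭₃-swap₁₂ ↭₃-swap₂₃) y≢z y∈ z∈ x∈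
  ... | true  | true  | true  | ()
  ... | true  | false | false | ()
  ... | false | true  | false | ()
  ... | false | false | true  | ()
  ... | false | false | false | ()

-- Congruences of integers

infix 4 _≡_⟨mod_⟩

record _≡_⟨mod_⟩ (x y : ℤ) (N : ℕ) : Set where
  constructor mk≡mod
  field
    quotient : ℤ
    equation : x ≡ y ℤ.+ quotient ℤ.* + N

module _ {N : ℕ} where

  ≡mod-refl : ∀ {x} → x ≡ x ⟨mod N ⟩
  ≡mod-refl {x} = mk≡mod (+ 0) (identity x (+ N))
    where
    identity : ∀ x n → x ≡ x ℤ.+ + 0 ℤ.* n
    identity = ℤ.solve-∀

  ≡mod-reflexive : ∀ {x y} → x ≡ y → x ≡ y ⟨mod N ⟩
  ≡mod-reflexive refl = ≡mod-refl

  ≡mod-sym : ∀ {x y} → x ≡ y ⟨mod N ⟩ → y ≡ x ⟨mod N ⟩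
  ≡mod-sym {y = y} (mk≡mod q e) =
    mk≡mod (ℤ.- q) (trans (identity y q (+ N)) (cong (λ w → w ℤ.+ (ℤ.- q) ℤ.* + N) (sym e)))
    where
    identity : ∀ y q n → y ≡ (y ℤ.+ q ℤ.* n) ℤ.+ (ℤ.- q) ℤ.* n
    identity = ℤ.solve-∀

  ≡mod-trans : ∀ {x y z} → x ≡ y ⟨mod N ⟩ → y ≡ z ⟨mod N ⟩ → x ≡ z ⟨mod N ⟩
  ≡mod-trans {z = z} (mk≡mod q e) (mk≡mod r f) =
    mk≡mod (q ℤ.+ r) (trans e (trans (cong (λ w → w ℤ.+ q ℤ.* + N) f) (identity z r q (+ N))))
    where
    identity : ∀ z r q n → (z ℤ.+ r ℤ.* n) ℤ.+ q ℤ.* n ≡ z ℤ.+ (q ℤ.+ r) ℤ.* n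
    identity = ℤ.solve-∀

  ≡mod-isEquivalence : IsEquivalence _≡_⟨mod N ⟩
  ≡mod-isEquivalence = record { refl = ≡mod-refl ; sym = ≡mod-sym ; trans = ≡mod-trans }

  ≡mod-+ : ∀ {x y x′ y′} → x ≡ y ⟨mod N ⟩ → x′ ≡ y′ ⟨mod N ⟩ → x ℤ.+ x′ ≡ y ℤ.+ y′ ⟨mod N ⟩
  ≡mod-+ {y = y} {y′ = y′} (mk≡mod q e) (mk≡mod r f) =
    mk≡mod (q ℤ.+ r) (trans (cong₂ ℤ._+_ e f) (identity y y′ q r (+ N)))
    where
    identity : ∀ y y′ q r n → (y ℤ.+ q ℤ.* n) ℤ.+ (y′ ℤ.+ r ℤ.* n) ≡ (y ℤ.+ y′) ℤ.+ (q ℤ.+ r) ℤ.* n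
    identity = ℤ.solve-∀

  ≡mod-*ˡ : ∀ k {x y} → x ≡ y ⟨mod N ⟩ → k ℤ.* x ≡ k ℤ.* y ⟨mod N ⟩
  ≡mod-*ˡ k {y = y} (mk≡mod q e) = mk≡mod (k ℤ.* q) (trans (cong (k ℤ.*_) e) (identity k y q (+ N)))
    where
    identity : ∀ k y q n → k ℤ.* (y ℤ.+ q ℤ.* n) ≡ k ℤ.* y ℤ.+ (k ℤ.* q) ℤ.* n
    identity = ℤ.solve-∀

  ≡mod-*ʳ : ∀ k {x y} → x ≡ y ⟨mod N ⟩ → x ℤ.* k ≡ y ℤ.* k ⟨mod N ⟩
  ≡mod-*ʳ k {x} {y} h = subst₂ _≡_⟨mod N ⟩ (ℤ.*-comm k x) (ℤ.*-comm k y) (≡mod-*ˡ k h)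

  ≡mod-cancelʳ-+ : ∀ k {x y} → x ℤ.+ k ≡ y ℤ.+ k ⟨mod N ⟩ → x ≡ y ⟨mod N ⟩
  ≡mod-cancelʳ-+ k {x} {y} h = subst₂ _≡_⟨mod N ⟩ (identity x k) (identity y k) (≡mod-+ h (≡mod-refl {ℤ.- k}))
    where
    identity : ∀ x k → x ℤ.+ k ℤ.+ ℤ.- k ≡ x
    identity = ℤ.solve-∀

  +-multiple-≡mod : ∀ w j → + (w + j * N) ≡ + w ⟨mod N ⟩
  +-multiple-≡mod w j = mk≡mod (+ j) (trans (ℤ.pos-+ w (j * N)) (cong (λ v → + w ℤ.+ v) (ℤ.pos-* j N)))

  %ℕ-≡mod : ∀ x .{{_ : NonZero N}} → + (x ℤ.%ℕ N) ≡ x ⟨mod N ⟩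
  %ℕ-≡mod x = ≡mod-sym (mk≡mod (x ℤ./ℕ N) (ℤ.a≡a%ℕn+[a/ℕn]*n x N))

  ∣⇒≡mod : ∀ {x y} → x ≡ y [mod N ] → x ≡ y ⟨mod N ⟩
  ∣⇒≡mod {x} {y} h with ℤ.∣ᵤ⇒∣ h
  ... | ℤ.divides q e = mk≡mod q (trans (identity x y) (cong (λ v → y ℤ.+ v) e))
    where
    identity : ∀ x y → x ≡ y ℤ.+ (x ℤ.- y)
    identity = ℤ.solve-∀

  ≡mod⇒∣ : ∀ {x y} → x ≡ y ⟨mod N ⟩ → x ≡ y [mod N ]
  ≡mod⇒∣ {x} {y} (mk≡mod q e) = ℤ.∣⇒∣ᵤ (ℤ.divides q (trans (cong (ℤ._- y) e) (identity y q (+ N))))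
    where
    identity : ∀ y q n → (y ℤ.+ q ℤ.* n) ℤ.- y ≡ q ℤ.* n
    identity = ℤ.solve-∀

  ≡mod⇒≡⊎apart : ∀ {X Y} → + X ≡ + Y ⟨mod N ⟩ → X ≡ Y ⊎ X + N ≤ Y ⊎ Y + N ≤ X
  ≡mod⇒≡⊎apart {Y = Y} (mk≡mod (+ zero) e) = inj₁ (ℤ.+-injective (trans e (identity (+ Y) (+ N))))
    where
    identity : ∀ y n → y ℤ.+ + 0 ℤ.* n ≡ y
    identity = ℤ.solve-∀
  ≡mod⇒≡⊎apart {X} {Y} (mk≡mod (+ suc k) e) =
    inj₂ (inj₂ (ℕ.≤-trans (ℕ.+-monoʳ-≤ Y (ℕ.m≤m+n N (k * N))) (ℕ.≤-reflexive (sym X≡))))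
    where
    X≡ : X ≡ Y + (N + k * N)
    X≡ = ℤ.+-injective (trans e (trans (cong (λ v → + Y ℤ.+ v) (sym (ℤ.pos-* (suc k) N)))
                                       (sym (ℤ.pos-+ Y (suc k * N)))))
  ≡mod⇒≡⊎apart {X} {Y} (mk≡mod -[1+ k ] e) =
    inj₂ (inj₁ (ℕ.≤-trans (ℕ.+-monoʳ-≤ X (ℕ.m≤m+n N (k * N))) (ℕ.≤-reflexive Y≡)))
    where
    identity : ∀ y a n → (y ℤ.+ (ℤ.- a) ℤ.* n) ℤ.+ a ℤ.* n ≡ y
    identity = ℤ.solve-∀
    Y≡ : X + (N + k * N) ≡ Y
    Y≡ = ℤ.+-injective (trans (ℤ.pos-+ X (suc k * N)) (trans (cong (λ v → + X ℤ.+ v) (ℤ.pos-* (suc k) N))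
           (trans (cong (ℤ._+ + suc k ℤ.* + N) e) (identity (+ Y) (+ suc k) (+ N)))))

  ≡mod-close⇒≡ : ∀ {X Y} → + X ≡ + Y ⟨mod N ⟩ → X < Y + N → Y < X + N → X ≡ Y
  ≡mod-close⇒≡ h X<Y+N Y<X+N with ≡mod⇒≡⊎apart h
  ... | inj₁ X≡Y         = X≡Y
  ... | inj₂ (inj₁ X+N≤Y) = ⊥-elim (ℕ.<-irrefl refl (ℕ.<-≤-trans Y<X+N X+N≤Y))
  ... | inj₂ (inj₂ Y+N≤X) = ⊥-elim (ℕ.<-irrefl refl (ℕ.<-≤-trans X<Y+N Y+N≤X))

  ≡mod-<⇒≡ : ∀ {X Y} → X < N → Y < N → + X ≡ + Y ⟨mod N ⟩ → X ≡ Y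
  ≡mod-<⇒≡ {X} {Y} X<N Y<N h =
    ≡mod-close⇒≡ h (ℕ.<-≤-trans X<N (ℕ.m≤n+m N Y)) (ℕ.<-≤-trans Y<N (ℕ.m≤n+m N X))

≡mod-setoid : ℕ → Setoid _ _
≡mod-setoid N = record { isEquivalence = ≡mod-isEquivalence {N} }

ThreeInvertible : ℕ → Set
ThreeInvertible N = Σ ℕ λ i → + (3 * i) ≡ + 1 ⟨mod N ⟩

≡mod-cancel-3 : ∀ {N} → ThreeInvertible N → ∀ {x y} → + 3 ℤ.* x ≡ + 3 ℤ.* y ⟨mod N ⟩ → x ≡ y ⟨mod N ⟩
≡mod-cancel-3 {N} (i , 3i≡1) {x} {y} h = begin
  x                          ≡⟨ ℤ.*-identityˡ x ⟨
  + 1 ℤ.* x                  ≈⟨ ≡mod-*ʳ x (≡mod-sym 3i≡1) ⟩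
  + (3 * i) ℤ.* x            ≡⟨ regroup x ⟩
  + i ℤ.* (+ 3 ℤ.* x)        ≈⟨ ≡mod-*ˡ (+ i) h ⟩
  + i ℤ.* (+ 3 ℤ.* y)        ≡⟨ regroup y ⟨
  + (3 * i) ℤ.* y            ≈⟨ ≡mod-*ʳ y 3i≡1 ⟩
  + 1 ℤ.* y                  ≡⟨ ℤ.*-identityˡ y ⟩
  y                          ∎
  where
  open SetoidReasoning (≡mod-setoid N)
  regroup : ∀ z → + (3 * i) ℤ.* z ≡ + i ℤ.* (+ 3 ℤ.* z)
  regroup z = trans (cong (ℤ._* z) (ℤ.pos-* 3 i)) (commute (+ 3) (+ i) z)
    where
    commute : ∀ a b z → a ℤ.* b ℤ.* z ≡ b ℤ.* (a ℤ.* z)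
    commute = ℤ.solve-∀

pos-sum₃ : ∀ a b c → + (a + b + c) ≡ + a ℤ.+ + b ℤ.+ + c
pos-sum₃ a b c = trans (ℤ.pos-+ (a + b) c) (cong (ℤ._+ + c) (ℤ.pos-+ a b))

≡mod-sum₃ : ∀ {N a b c a′ b′ c′} → + a ≡ + a′ ⟨mod N ⟩ → + b ≡ + b′ ⟨mod N ⟩ → + c ≡ + c′ ⟨mod N ⟩ →
            + (a + b + c) ≡ + (a′ + b′ + c′) ⟨mod N ⟩
≡mod-sum₃ {N} {a} {b} {c} {a′} {b′} {c′} a≡ b≡ c≡ =
  subst₂ _≡_⟨mod N ⟩ (sym (pos-sum₃ a b c)) (sym (pos-sum₃ a′ b′ c′)) (≡mod-+ (≡mod-+ a≡ b≡) c≡)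

-- Lifting a triple into a window of length m

discreteIVT : ∀ {d} (f : ℕ → ℕ) → (∀ k → f (suc k) ≤ f k + d) → ∀ {L} → f 0 < L → ∀ K → L ≤ f K →
              Σ ℕ λ θ → θ ≤ K × L ≤ f θ × f θ < L + d
discreteIVT f step f0<L zero L≤f0 = ⊥-elim (ℕ.<-irrefl refl (ℕ.<-≤-trans f0<L L≤f0))
discreteIVT {d} f step {L} f0<L (suc K) L≤fK+1 with L ℕ.≤? f K
... | yes L≤fK = let θ , θ≤K , rest = discreteIVT f step f0<L K L≤fK in θ , ℕ.m≤n⇒m≤1+n θ≤K , rest
... | no L≰fK  = suc K , ℕ.≤-refl , L≤fK+1 , ℕ.≤-<-trans (step K) (ℕ.+-monoˡ-< d (ℕ.≰⇒> L≰fK))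

module Lifting (m : ℕ) where

  lift : ℕ → ℕ → ℕ
  lift θ w with w <? θ
  ... | yes _ = w + m
  ... | no _  = w

  InWindow : ℕ → ℕ → Set
  InWindow θ X = θ ≤ X × X < θ + m

  inWindow-close : ∀ {N θ X Y} → m ≤ N → InWindow θ X → InWindow θ Y → X < Y + N
  inWindow-close m≤N (_ , X<θ+m) (θ≤Y , _) = ℕ.<-≤-trans X<θ+m (ℕ.+-mono-≤ θ≤Y m≤N)

  lift-inWindow : ∀ {θ w} → θ ≤ m → w < m → InWindow θ (lift θ w)
  lift-inWindow {θ} {w} θ≤m w<m with w <? θ
  ... | yes w<θ = ℕ.≤-trans θ≤m (ℕ.m≤n+m m w) , ℕ.+-monoˡ-< m w<θ
  ... | no w≮θ  = ℕ.≮⇒≥ w≮θ , ℕ.<-≤-trans w<m (ℕ.m≤n+m m θ)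

  lift-≡mod : ∀ θ w → + lift θ w ≡ + w ⟨mod m ⟩
  lift-≡mod θ w with w <? θ
  ... | yes _ = subst (λ k → + (w + k) ≡ + w ⟨mod m ⟩) (ℕ.*-identityˡ m) (+-multiple-≡mod w 1)
  ... | no _  = ≡mod-refl

  lift-zero : ∀ w → lift 0 w ≡ w
  lift-zero w with w <? 0
  ... | no _ = refl

  lift-below : ∀ {θ w} → w < θ → lift θ w ≡ w + m
  lift-below {θ} {w} w<θ with w <? θ
  ... | yes _   = refl
  ... | no w≮θ = ⊥-elim (w≮θ w<θ)

  lift-suc-≢ : ∀ {θ w} → w ≢ θ → lift (suc θ) w ≡ lift θ w
  lift-suc-≢ {θ} {w} w≢θ with w <? suc θ | w <? θ
  ... | yes _         | yes _   = refl
  ... | no _          | no _    = refl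
  ... | yes (s≤s w≤θ) | no w≮θ = ⊥-elim (w≢θ (ℕ.≤-antisym w≤θ (ℕ.≮⇒≥ w≮θ)))
  ... | no w≮1+θ      | yes w<θ = ⊥-elim (w≮1+θ (ℕ.m<n⇒m<1+n w<θ))

  lift-suc-≤ : ∀ θ w → lift (suc θ) w ≤ lift θ w + m
  lift-suc-≤ θ w with w <? suc θ | w <? θ
  ... | yes _ | yes _ = ℕ.m≤m+n (w + m) m
  ... | yes _ | no _  = ℕ.≤-refl
  ... | no _  | yes _ = ℕ.≤-trans (ℕ.m≤m+n w m) (ℕ.m≤m+n (w + m) m)
  ... | no _  | no _  = ℕ.m≤m+n w m

  liftSum : ℕ → ℕ ³ → ℕ
  liftSum θ t = sum₃ (map₃ (lift θ) t)

  liftSum-≡mod : ∀ θ t → + liftSum θ t ≡ + sum₃ t ⟨mod m ⟩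
  liftSum-≡mod θ (a , b , c) = ≡mod-sum₃ (lift-≡mod θ a) (lift-≡mod θ b) (lift-≡mod θ c)

  liftSum-↭₃ : ∀ θ {s t} → s ↭₃ t → liftSum θ s ≡ liftSum θ t
  liftSum-↭₃ θ p = sum₃-↭₃ (↭₃-map (lift θ) p)

  liftSum-suc-front : ∀ θ {x y z} → y ≢ θ → z ≢ θ →
                      liftSum (suc θ) (x , y , z) ≤ liftSum θ (x , y , z) + m
  liftSum-suc-front θ {x} {y} {z} y≢θ z≢θ = begin
    lift (suc θ) x + lift (suc θ) y + lift (suc θ) z
      ≡⟨ cong₂ (λ p q → lift (suc θ) x + p + q) (lift-suc-≢ y≢θ) (lift-suc-≢ z≢θ) ⟩
    lift (suc θ) x + lift θ y + lift θ z
      ≤⟨ ℕ.+-monoˡ-≤ (lift θ z) (ℕ.+-monoˡ-≤ (lift θ y) (lift-suc-≤ θ x)) ⟩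
    lift θ x + m + lift θ y + lift θ z
      ≡⟨ move-m (lift θ x) (lift θ y) (lift θ z) m ⟩
    lift θ x + lift θ y + lift θ z + m ∎
    where
    open ℕ.≤-Reasoning
    move-m : ∀ p q r k → p + k + q + r ≡ p + q + r + k
    move-m = ℕ.solve-∀

  liftSum-suc : ∀ θ t → Distinct₃ t → liftSum (suc θ) t ≤ liftSum θ t + m
  liftSum-suc θ (a , b , c) (a≢b , b≢c , a≢c) with a ℕ.≟ θ | b ℕ.≟ θ | c ℕ.≟ θ
  ... | yes refl | _        | _        = liftSum-suc-front θ (a≢b ∘ sym) (a≢c ∘ sym)
  ... | no a≢θ   | yes refl | _        =
    subst₂ (λ x y → x ≤ y + m) (liftSum-↭₃ (suc θ) b-to-back) (liftSum-↭₃ θ b-to-back)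
      (liftSum-suc-front θ a≢θ (b≢c ∘ sym))
    where
    b-to-back : (b , a , c) ↭₃ (a , b , c)
    b-to-back = ↭₃-swap₁₂
  ... | no a≢θ   | no b≢θ   | yes refl =
    subst₂ (λ x y → x ≤ y + m) (liftSum-↭₃ (suc θ) c-to-back) (liftSum-↭₃ θ c-to-back)
      (liftSum-suc-front θ a≢θ b≢θ)
    where
    c-to-back : (c , a , b) ↭₃ (a , b , c)
    c-to-back = ↭₃-trans ↭₃-swap₁₂ ↭₃-swap₂₃
  ... | no a≢θ   | no b≢θ   | no c≢θ   =
    ℕ.≤-trans (ℕ.≤-reflexive unchanged) (ℕ.m≤m+n (liftSum θ (a , b , c)) m)
    where
    unchanged : liftSum (suc θ) (a , b , c) ≡ liftSum θ (a , b , c)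
    unchanged = cong₂ _+_ (cong₂ _+_ (lift-suc-≢ a≢θ) (lift-suc-≢ b≢θ)) (lift-suc-≢ c≢θ)

  private
    thrice : ∀ k → k + k + k ≡ 3 * k
    thrice = ℕ.solve-∀

  liftSum-zero-< : ∀ t → All₃ (_< m) t → liftSum 0 t < 3 * m
  liftSum-zero-< (a , b , c) (a<m , b<m , c<m) =
    subst₂ _<_ (sym (cong₂ _+_ (cong₂ _+_ (lift-zero a) (lift-zero b)) (lift-zero c))) (thrice m)
      (ℕ.+-mono-< (ℕ.+-mono-< a<m b<m) c<m)

  liftSum-full-≥ : ∀ t → All₃ (_< m) t → 3 * m ≤ liftSum m t
  liftSum-full-≥ (a , b , c) (a<m , b<m , c<m) =
    subst₂ _≤_ (thrice m) (sym (cong₂ _+_ (cong₂ _+_ (lift-below a<m) (lift-below b<m)) (lift-below c<m)))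
      (ℕ.+-mono-≤ (ℕ.+-mono-≤ (ℕ.m≤n+m m a) (ℕ.m≤n+m m b)) (ℕ.m≤n+m m c))

  balancedLift : ∀ t → Distinct₃ t → All₃ (_< m) t → ∀ {σ} → σ < m → + sum₃ t ≡ + σ ⟨mod m ⟩ →
                 Σ ℕ λ θ → θ ≤ m × liftSum θ t ≡ 3 * m + σ
  balancedLift t distinct t<m {σ} σ<m sum≡σ
    with discreteIVT (λ θ → liftSum θ t) (λ θ → liftSum-suc θ t distinct)
                     (liftSum-zero-< t t<m) m (liftSum-full-≥ t t<m)
  ... | θ , θ≤m , 3m≤sum , sum<4m = θ , θ≤m , ≡mod-close⇒≡ congruent upper lower
    where
    congruent : + liftSum θ t ≡ + (3 * m + σ) ⟨mod m ⟩
    congruent = ≡mod-trans (liftSum-≡mod θ t) (≡mod-trans sum≡σ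
                  (≡mod-sym (subst (λ k → + k ≡ + σ ⟨mod m ⟩) (ℕ.+-comm σ (3 * m)) (+-multiple-≡mod σ 3))))
    upper : liftSum θ t < 3 * m + σ + m
    upper = ℕ.<-≤-trans sum<4m (ℕ.+-monoˡ-≤ m (ℕ.m≤m+n (3 * m) σ))
    lower : 3 * m + σ < liftSum θ t + m
    lower = ℕ.<-≤-trans (ℕ.+-monoʳ-< (3 * m) σ<m) (ℕ.+-monoˡ-≤ m 3m≤sum)

  record Balanced (t : ℕ ³) : Set where
    field
      start    : ℕ
      excess   : ℕ
      excess≤1 : excess ≤ 1
      inWindow : All₃ (InWindow start) t
      sum≡     : sum₃ t ≡ 3 * m + excess

  open Balanced

  Balanced-sum-≤ : ∀ {s t} → Balanced s → Balanced t → sum₃ s ≤ sum₃ t + 1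
  Balanced-sum-≤ {s} {t} bs bt = begin
    sum₃ s                    ≡⟨ sum≡ bs ⟩
    3 * m + excess bs         ≤⟨ ℕ.+-monoʳ-≤ (3 * m) (ℕ.≤-trans (excess≤1 bs) (ℕ.m≤n+m 1 (excess bt))) ⟩
    3 * m + (excess bt + 1)   ≡⟨ ℕ.+-assoc (3 * m) (excess bt) 1 ⟨
    3 * m + excess bt + 1     ≡⟨ cong (_+ 1) (sum≡ bt) ⟨
    sum₃ t + 1                ∎
    where open ℕ.≤-Reasoning

  Balanced-swap₁₂ : ∀ {a b c} → Balanced (a , b , c) → Balanced (b , a , c)
  Balanced-swap₁₂ {a} {b} {c} bt = record
    { start = start bt ; excess = excess bt ; excess≤1 = excess≤1 bt
    ; inWindow = let wa , wb , wc = inWindow bt in wb , wa , wc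
    ; sum≡ = trans (cong (_+ c) (ℕ.+-comm b a)) (sum≡ bt) }

  private
    congruent-not-below : ∀ {N θ θ′ X X′} → m ≤ N → θ ≤ θ′ → X < θ + m → θ′ ≤ X′ →
                          + X ≡ + X′ ⟨mod N ⟩ → X ≡ X′ ⊎ X + N ≤ X′
    congruent-not-below {N} {θ} {θ′} {X} {X′} m≤N θ≤θ′ X<θ+m θ′≤X′ X≡X′ with ≡mod⇒≡⊎apart X≡X′
    ... | inj₁ eq           = inj₁ eq
    ... | inj₂ (inj₁ X+N≤X′) = inj₂ X+N≤X′
    ... | inj₂ (inj₂ X′+N≤X) = ⊥-elim (ℕ.<-irrefl refl (begin-strict
      X       <⟨ X<θ+m ⟩
      θ + m   ≤⟨ ℕ.+-mono-≤ θ≤θ′ m≤N ⟩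
      θ′ + N  ≤⟨ ℕ.+-monoˡ-≤ N θ′≤X′ ⟩
      X′ + N  ≤⟨ X′+N≤X ⟩
      X       ∎))
      where open ℕ.≤-Reasoning

  -- If A′ = A + N, then comparing sums gives N + θ′ ≤ θ + m, while A′ < θ′ + m gives
  -- θ + N < θ′ + m; adding them yields N < m.
  Balanced-first-rigid : ∀ {N A B C A′ B′ C′} → m ≤ N →
    (bs : Balanced (A , B , C)) (bt : Balanced (A′ , B′ , C′)) → start bs ≤ start bt →
    + A ≡ + A′ ⟨mod N ⟩ → + B ≡ + B′ ⟨mod N ⟩ → A ≡ A′
  Balanced-first-rigid {N} {A} {B} {C} {A′} {B′} {C′} m≤N bs bt θ≤θ′ A≡A′ B≡B′
    with (θ≤A , A<θ+m) , (_ , B<θ+m) , (_ , C<θ+m) ← inWindow bs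
       | (θ′≤A′ , A′<θ′+m) , (θ′≤B′ , _) , (θ′≤C′ , _) ← inWindow bt
    with congruent-not-below m≤N θ≤θ′ A<θ+m θ′≤A′ A≡A′
  ... | inj₁ A≡A′ = A≡A′
  ... | inj₂ A+N≤A′ = ⊥-elim (ℕ.<-irrefl refl (ℕ.<-≤-trans N+N<m+m (ℕ.+-mono-≤ m≤N m≤N)))
    where
    θ = start bs
    θ′ = start bt
    B≤B′ : B ≤ B′
    B≤B′ with congruent-not-below m≤N θ≤θ′ B<θ+m θ′≤B′ B≡B′
    ... | inj₁ eq      = ℕ.≤-reflexive eq
    ... | inj₂ B+N≤B′ = ℕ.≤-trans (ℕ.m≤m+n B N) B+N≤B′
    open ℕ.≤-Reasoning
    regroup₁ : ∀ a b n t → (a + b) + (n + t) ≡ a + n + b + t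
    regroup₁ = ℕ.solve-∀
    regroup₂ : ∀ a b c → a + b + c + 1 ≡ (a + b) + suc c
    regroup₂ = ℕ.solve-∀
    regroup₃ : ∀ n t t′ → (n + n) + (t + t′) ≡ (n + t′) + (t + n)
    regroup₃ = ℕ.solve-∀
    regroup₄ : ∀ m t t′ → (t + m) + (t′ + m) ≡ (m + m) + (t + t′)
    regroup₄ = ℕ.solve-∀
    N+θ′≤θ+m : N + θ′ ≤ θ + m
    N+θ′≤θ+m = ℕ.+-cancelˡ-≤ (A + B) (N + θ′) (θ + m) (begin
      (A + B) + (N + θ′) ≡⟨ regroup₁ A B N θ′ ⟩
      A + N + B + θ′     ≤⟨ ℕ.+-mono-≤ (ℕ.+-mono-≤ A+N≤A′ B≤B′) θ′≤C′ ⟩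
      A′ + B′ + C′       ≤⟨ Balanced-sum-≤ bt bs ⟩
      A + B + C + 1      ≡⟨ regroup₂ A B C ⟩
      (A + B) + suc C    ≤⟨ ℕ.+-monoʳ-≤ (A + B) C<θ+m ⟩
      (A + B) + (θ + m)  ∎)
    θ+N<θ′+m : θ + N < θ′ + m
    θ+N<θ′+m = ℕ.≤-<-trans (ℕ.+-monoˡ-≤ N θ≤A) (ℕ.≤-<-trans A+N≤A′ A′<θ′+m)
    N+N<m+m : N + N < m + m
    N+N<m+m = ℕ.+-cancelʳ-< (θ + θ′) (N + N) (m + m) (begin-strict
      (N + N) + (θ + θ′)  ≡⟨ regroup₃ N θ θ′ ⟩
      (N + θ′) + (θ + N)  <⟨ ℕ.+-mono-≤-< N+θ′≤θ+m θ+N<θ′+m ⟩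
      (θ + m) + (θ′ + m)  ≡⟨ regroup₄ m θ θ′ ⟩
      (m + m) + (θ + θ′)  ∎)

  Balanced-pair-rigid : ∀ {N A B C A′ B′ C′} → m ≤ N → Balanced (A , B , C) → Balanced (A′ , B′ , C′) →
    + A ≡ + A′ ⟨mod N ⟩ → + B ≡ + B′ ⟨mod N ⟩ → A ≡ A′ × B ≡ B′
  Balanced-pair-rigid m≤N bs bt A≡A′ B≡B′ =
    first m≤N bs bt A≡A′ B≡B′ , first m≤N (Balanced-swap₁₂ bs) (Balanced-swap₁₂ bt) B≡B′ A≡A′
    where
    first : ∀ {N A B C A′ B′ C′} → m ≤ N → Balanced (A , B , C) → Balanced (A′ , B′ , C′) →
            + A ≡ + A′ ⟨mod N ⟩ → + B ≡ + B′ ⟨mod N ⟩ → A ≡ A′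
    first m≤N bs bt A≡A′ B≡B′ with ℕ.≤-total (start bs) (start bt)
    ... | inj₁ θ≤θ′ = Balanced-first-rigid m≤N bs bt θ≤θ′ A≡A′ B≡B′
    ... | inj₂ θ′≤θ = sym (Balanced-first-rigid m≤N bt bs θ′≤θ (≡mod-sym A≡A′) (≡mod-sym B≡B′))

  Balanced-third-rigid : ∀ {N A B C C′} → 2 ≤ N → Balanced (A , B , C) → Balanced (A , B , C′) →
    + C ≡ + C′ ⟨mod N ⟩ → C ≡ C′
  Balanced-third-rigid {N} {A} {B} {C} {C′} 2≤N bs bt C≡C′ =
    ≡mod-close⇒≡ C≡C′ (close bs bt) (close bt bs)
    where
    close : ∀ {X Y} → Balanced (A , B , X) → Balanced (A , B , Y) → X < Y + N
    close {X} {Y} bx by = ℕ.≤-<-trans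
      (ℕ.+-cancelˡ-≤ (A + B) X (Y + 1) (subst (A + B + X ≤_) (ℕ.+-assoc (A + B) Y 1) (Balanced-sum-≤ bx by)))
      (ℕ.+-monoʳ-< Y 2≤N)

-- The coordinates a = 3u + c and the embedding

threeInvertible : ∀ N → N % 6 ≡ 1 ⊎ N % 6 ≡ 5 → ThreeInvertible N
threeInvertible N (inj₁ N%6≡1) =
  4 * q + 1 , subst (λ k → + k ≡ + 1 ⟨mod N ⟩) (sym (trans (identity q) (cong (λ k → 1 + 2 * k) (sym N≡))))
                    (+-multiple-≡mod 1 2)
  where
  q = N / 6
  N≡ : N ≡ 1 + q * 6
  N≡ = trans (m≡m%n+[m/n]*n N 6) (cong (_+ q * 6) N%6≡1)
  identity : ∀ q → 3 * (4 * q + 1) ≡ 1 + 2 * (1 + q * 6)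
  identity = ℕ.solve-∀
threeInvertible N (inj₂ N%6≡5) =
  2 * q + 2 , subst (λ k → + k ≡ + 1 ⟨mod N ⟩) (sym (trans (identity q) (cong (λ k → 1 + 1 * k) (sym N≡))))
                    (+-multiple-≡mod 1 1)
  where
  q = N / 6
  N≡ : N ≡ 5 + q * 6
  N≡ = trans (m≡m%n+[m/n]*n N 6) (cong (_+ q * 6) N%6≡5)
  identity : ∀ q → 3 * (2 * q + 2) ≡ 1 + 1 * (5 + q * 6)
  identity = ℕ.solve-∀

module Coordinates (c : ℤ) (N : ℕ) .{{_ : NonZero N}} (3⁻¹ : ThreeInvertible N) where

  opaque
    decode : ℕ → Fin N
    decode w = fromℕ< (ℤ.n%ℕd<d (+ 3 ℤ.* + w ℤ.+ c) N)

    decode-≡mod : ∀ w → + toℕ (decode w) ≡ + 3 ℤ.* + w ℤ.+ c ⟨mod N ⟩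
    decode-≡mod w = subst (λ k → + k ≡ + 3 ℤ.* + w ℤ.+ c ⟨mod N ⟩)
      (sym (Fin.toℕ-fromℕ< (ℤ.n%ℕd<d (+ 3 ℤ.* + w ℤ.+ c) N))) (%ℕ-≡mod (+ 3 ℤ.* + w ℤ.+ c))

  decode-injective : ∀ {w w′} → decode w ≡ decode w′ → + w ≡ + w′ ⟨mod N ⟩
  decode-injective {w} {w′} e = ≡mod-cancel-3 3⁻¹ (≡mod-cancelʳ-+ c (begin
    + 3 ℤ.* + w ℤ.+ c   ≈⟨ decode-≡mod w ⟨
    + toℕ (decode w)    ≡⟨ cong (λ a → + toℕ a) e ⟩
    + toℕ (decode w′)   ≈⟨ decode-≡mod w′ ⟩
    + 3 ℤ.* + w′ ℤ.+ c  ∎))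
    where open SetoidReasoning (≡mod-setoid N)

  opaque
    encode : Fin N → ℕ
    encode a = ((+ toℕ a ℤ.- c) ℤ.* + proj₁ 3⁻¹) ℤ.%ℕ N

    encode<N : ∀ a → encode a < N
    encode<N a = ℤ.n%ℕd<d ((+ toℕ a ℤ.- c) ℤ.* + proj₁ 3⁻¹) N

    encode-≡mod : ∀ a → + 3 ℤ.* + encode a ℤ.+ c ≡ + toℕ a ⟨mod N ⟩
    encode-≡mod a = begin
      + 3 ℤ.* + encode a ℤ.+ c
        ≈⟨ ≡mod-+ (≡mod-*ˡ (+ 3) (%ℕ-≡mod ((+ toℕ a ℤ.- c) ℤ.* + proj₁ 3⁻¹))) ≡mod-refl ⟩
      + 3 ℤ.* ((+ toℕ a ℤ.- c) ℤ.* + proj₁ 3⁻¹) ℤ.+ c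
        ≡⟨ regroup (proj₁ 3⁻¹) (+ toℕ a ℤ.- c) ⟩
      + (3 * proj₁ 3⁻¹) ℤ.* (+ toℕ a ℤ.- c) ℤ.+ c
        ≈⟨ ≡mod-+ (≡mod-*ʳ (+ toℕ a ℤ.- c) (proj₂ 3⁻¹)) ≡mod-refl ⟩
      + 1 ℤ.* (+ toℕ a ℤ.- c) ℤ.+ c
        ≡⟨ cancel (+ toℕ a) c ⟩
      + toℕ a ∎
      where
      open SetoidReasoning (≡mod-setoid N)
      commute : ∀ a b z → a ℤ.* (z ℤ.* b) ≡ a ℤ.* b ℤ.* z
      commute = ℤ.solve-∀
      regroup : ∀ i z → + 3 ℤ.* (z ℤ.* + i) ℤ.+ c ≡ + (3 * i) ℤ.* z ℤ.+ c
      regroup i z = cong (ℤ._+ c) (trans (commute (+ 3) (+ i) z) (cong (ℤ._* z) (sym (ℤ.pos-* 3 i))))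
      cancel : ∀ x c → + 1 ℤ.* (x ℤ.- c) ℤ.+ c ≡ x
      cancel = ℤ.solve-∀

  encode-injective : ∀ {a b} → + encode a ≡ + encode b ⟨mod N ⟩ → a ≡ b
  encode-injective {a} {b} h = Fin.toℕ-injective (≡mod-<⇒≡ (Fin.toℕ<n a) (Fin.toℕ<n b) (begin
    + toℕ a                  ≈⟨ encode-≡mod a ⟨
    + 3 ℤ.* + encode a ℤ.+ c ≈⟨ ≡mod-+ (≡mod-*ˡ (+ 3) h) ≡mod-refl ⟩
    + 3 ℤ.* + encode b ℤ.+ c ≈⟨ encode-≡mod b ⟩
    + toℕ b                  ∎))
    where open SetoidReasoning (≡mod-setoid N)

module Embedding (m : ℕ) .{{_ : NonZero m}} (g : ℤ)
                 (3⁻¹ₘ : ThreeInvertible m) (3⁻¹ₙ : ThreeInvertible (6 + m)) where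

  n : ℕ
  n = 6 + m

  c : ℤ
  c = g ℤ.- + 1

  open Lifting m
  open Coordinates c m 3⁻¹ₘ using (encode; encode<N; encode-≡mod; encode-injective)
  -- Decoding with offset c + 18 = c + 3·6 adds 6 to every lifted value.
  open Coordinates (c ℤ.+ + 18) n 3⁻¹ₙ using (decode; decode-≡mod; decode-injective)

  m≤n : m ≤ n
  m≤n = ℕ.m≤n+m m 6

  VertexSum : ℕ → ℤ → Set
  VertexSum N T = (T ≡ + 3 ℤ.* (g ℤ.- + 1) [mod N ]) ⊎ (T ≡ + 3 ℤ.* g [mod N ])

  -- Class σ = 0 is the sum 3(g − 1), class σ = 1 the sum 3g.
  InClass : ℕ → ℕ → ℤ → Set
  InClass N σ T = T ≡ + (3 * σ) ℤ.+ + 3 ℤ.* c ⟨mod N ⟩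

  private
    class₀ : ∀ g → + 3 ℤ.* (g ℤ.- + 1) ≡ + 0 ℤ.+ + 3 ℤ.* (g ℤ.- + 1)
    class₀ = ℤ.solve-∀
    class₁ : ∀ g → + 3 ℤ.* g ≡ + 3 ℤ.+ + 3 ℤ.* (g ℤ.- + 1)
    class₁ = ℤ.solve-∀

  vertexSum⇒class : ∀ {T} → VertexSum m T → Σ ℕ λ σ → σ ≤ 1 × InClass m σ T
  vertexSum⇒class (inj₁ h) = 0 , z≤n , ≡mod-trans (∣⇒≡mod h) (≡mod-reflexive (class₀ g))
  vertexSum⇒class (inj₂ h) = 1 , ℕ.≤-refl , ≡mod-trans (∣⇒≡mod h) (≡mod-reflexive (class₁ g))

  class⇒vertexSum : ∀ {N σ T} → σ ≤ 1 → InClass N σ T → VertexSum N T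
  class⇒vertexSum {σ = 0}           _         h = inj₁ (≡mod⇒∣ (≡mod-trans h (≡mod-reflexive (sym (class₀ g)))))
  class⇒vertexSum {σ = 1}           _         h = inj₂ (≡mod⇒∣ (≡mod-trans h (≡mod-reflexive (sym (class₁ g)))))
  class⇒vertexSum {σ = suc (suc _)} (s≤s ()) _

  encode-sum : ∀ t {σ} → InClass m σ (tsum t) → + sum₃ (map₃ encode t) ≡ + σ ⟨mod m ⟩
  encode-sum (x , y , z) {σ} h = ≡mod-cancel-3 3⁻¹ₘ (≡mod-cancelʳ-+ (+ 3 ℤ.* c) (begin
    + 3 ℤ.* + (encode x + encode y + encode z) ℤ.+ + 3 ℤ.* c
      ≡⟨ cong (λ k → + 3 ℤ.* k ℤ.+ + 3 ℤ.* c) (pos-sum₃ (encode x) (encode y) (encode z)) ⟩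
    + 3 ℤ.* (+ encode x ℤ.+ + encode y ℤ.+ + encode z) ℤ.+ + 3 ℤ.* c
      ≡⟨ distribute (+ encode x) (+ encode y) (+ encode z) c ⟩
    (+ 3 ℤ.* + encode x ℤ.+ c) ℤ.+ (+ 3 ℤ.* + encode y ℤ.+ c) ℤ.+ (+ 3 ℤ.* + encode z ℤ.+ c)
      ≈⟨ ≡mod-+ (≡mod-+ (encode-≡mod x) (encode-≡mod y)) (encode-≡mod z) ⟩
    + toℕ x ℤ.+ + toℕ y ℤ.+ + toℕ z
      ≡⟨ pos-sum₃ (toℕ x) (toℕ y) (toℕ z) ⟨
    tsum (x , y , z)
      ≈⟨ h ⟩
    + (3 * σ) ℤ.+ + 3 ℤ.* c
      ≡⟨ cong (ℤ._+ + 3 ℤ.* c) (ℤ.pos-* 3 σ) ⟩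
    + 3 ℤ.* + σ ℤ.+ + 3 ℤ.* c ∎))
    where
    open SetoidReasoning (≡mod-setoid m)
    distribute : ∀ a b d c → + 3 ℤ.* (a ℤ.+ b ℤ.+ d) ℤ.+ + 3 ℤ.* c ≡
                             (+ 3 ℤ.* a ℤ.+ c) ℤ.+ (+ 3 ℤ.* b ℤ.+ c) ℤ.+ (+ 3 ℤ.* d ℤ.+ c)
    distribute = ℤ.solve-∀

  decode-sum : ∀ {A B C σ} → A + B + C ≡ 3 * m + σ →
               InClass n σ (+ sum₃ (map₃ (toℕ ∘ decode) (A , B , C)))
  decode-sum {A} {B} {C} {σ} sum≡ = begin
    + (toℕ (decode A) + toℕ (decode B) + toℕ (decode C))
      ≡⟨ pos-sum₃ (toℕ (decode A)) (toℕ (decode B)) (toℕ (decode C)) ⟩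
    + toℕ (decode A) ℤ.+ + toℕ (decode B) ℤ.+ + toℕ (decode C)
      ≈⟨ ≡mod-+ (≡mod-+ (decode-≡mod A) (decode-≡mod B)) (decode-≡mod C) ⟩
    (+ 3 ℤ.* + A ℤ.+ c′) ℤ.+ (+ 3 ℤ.* + B ℤ.+ c′) ℤ.+ (+ 3 ℤ.* + C ℤ.+ c′)
      ≡⟨ collect (+ A) (+ B) (+ C) c ⟩
    + 3 ℤ.* (+ A ℤ.+ + B ℤ.+ + C) ℤ.+ + 54 ℤ.+ + 3 ℤ.* c
      ≡⟨ cong (λ k → + 3 ℤ.* k ℤ.+ + 54 ℤ.+ + 3 ℤ.* c)
              (trans (sym (pos-sum₃ A B C)) (cong (λ k → + k) sum≡)) ⟩
    + 3 ℤ.* + (3 * m + σ) ℤ.+ + 54 ℤ.+ + 3 ℤ.* c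
      ≡⟨ cong (ℤ._+ + 3 ℤ.* c) (trans (cong (ℤ._+ + 54) (sym (ℤ.pos-* 3 (3 * m + σ))))
                                      (sym (ℤ.pos-+ (3 * (3 * m + σ)) 54))) ⟩
    + (3 * (3 * m + σ) + 54) ℤ.+ + 3 ℤ.* c
      ≡⟨ cong (λ k → + k ℤ.+ + 3 ℤ.* c) (nine-n m σ) ⟩
    + (3 * σ + 9 * n) ℤ.+ + 3 ℤ.* c
      ≈⟨ ≡mod-+ (+-multiple-≡mod (3 * σ) 9) (≡mod-refl {x = + 3 ℤ.* c}) ⟩
    + (3 * σ) ℤ.+ + 3 ℤ.* c ∎
    where
    open SetoidReasoning (≡mod-setoid n)
    c′ = c ℤ.+ + 18
    collect : ∀ a b d c →
      (+ 3 ℤ.* a ℤ.+ (c ℤ.+ + 18)) ℤ.+ (+ 3 ℤ.* b ℤ.+ (c ℤ.+ + 18)) ℤ.+ (+ 3 ℤ.* d ℤ.+ (c ℤ.+ + 18))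
        ≡ + 3 ℤ.* (a ℤ.+ b ℤ.+ d) ℤ.+ + 54 ℤ.+ + 3 ℤ.* c
    collect = ℤ.solve-∀
    nine-n : ∀ m σ → 3 * (3 * m + σ) + 54 ≡ 3 * σ + 9 * (6 + m)
    nine-n = ℕ.solve-∀

  V : ℕ → Fin m → ℕ
  V θ a = lift θ (encode a)

  E : ℕ → Fin m → Fin n
  E θ a = decode (V θ a)

  V-inWindow : ∀ {θ} → θ ≤ m → ∀ a → InWindow θ (V θ a)
  V-inWindow θ≤m a = lift-inWindow θ≤m (encode<N a)

  V-injective : ∀ θ θ′ {a b} → V θ a ≡ V θ′ b → a ≡ b
  V-injective θ θ′ {a} {b} e = encode-injective (begin
    + encode a  ≈⟨ lift-≡mod θ (encode a) ⟨
    + V θ a     ≡⟨ cong (λ k → + k) e ⟩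
    + V θ′ b    ≈⟨ lift-≡mod θ′ (encode b) ⟩
    + encode b  ∎)
    where open SetoidReasoning (≡mod-setoid m)

  E-injective : ∀ {θ} → θ ≤ m → ∀ {a b} → E θ a ≡ E θ b → a ≡ b
  E-injective {θ} θ≤m {a} {b} e = V-injective θ θ (≡mod-close⇒≡ (decode-injective e)
    (inWindow-close m≤n (V-inWindow θ≤m a) (V-inWindow θ≤m b))
    (inWindow-close m≤n (V-inWindow θ≤m b) (V-inWindow θ≤m a)))

  record VertexLift (t : Fin m ³) : Set where
    field
      θ    : ℕ
      θ≤m  : θ ≤ m
      σ    : ℕ
      σ≤1  : σ ≤ 1
      sum≡ : sum₃ (map₃ (V θ) t) ≡ 3 * m + σ

  -- Opaque, so that unification never evaluates the search for θ.
  opaque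
    vertexLift : (v : Vertex m g) → VertexLift (proj₁ v)
    vertexLift ((x , y , z) , (x<y , y<z) , vertexSum) =
      let σ , σ≤1 , inClass = vertexSum⇒class vertexSum
          θ , θ≤m , sum≡ = balancedLift (map₃ encode (x , y , z))
            (Distinct₃-map (encode-injective ∘ ≡mod-reflexive ∘ cong (λ k → + k)) (x , y , z)
                           (ascending⇒distinct (x<y , y<z)))
            (encode<N x , encode<N y , encode<N z) (ℕ.≤-<-trans σ≤1 1<m) (encode-sum (x , y , z) inClass)
      in record { θ = θ ; θ≤m = θ≤m ; σ = σ ; σ≤1 = σ≤1 ; sum≡ = sum≡ }
      where
      1<m : 1 < m
      1<m = ℕ.≤-<-trans (ℕ.≤-trans (s≤s z≤n) x<y) (ℕ.<-trans y<z (Fin.toℕ<n z))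

  balanced : ∀ {t} (L : VertexLift t) {t′} → t ↭₃ t′ → Balanced (map₃ (V (VertexLift.θ L)) t′)
  balanced L {a , b , d} p = record
    { start    = θ
    ; excess   = σ
    ; excess≤1 = σ≤1
    ; inWindow = V-inWindow θ≤m a , V-inWindow θ≤m b , V-inWindow θ≤m d
    ; sum≡     = trans (sym (sum₃-↭₃ (↭₃-map (V θ) p))) sum≡
    }
    where open VertexLift L

  Eᵥ : Vertex m g → Fin m → Fin n
  Eᵥ v = E (VertexLift.θ (vertexLift v))

  image : (v : Vertex m g) → Σ (Fin n ³) λ s → Ascending (map₃ toℕ s) × map₃ (Eᵥ v) (proj₁ v) ↭₃ s
  image v = sort₃ (map₃ (Eᵥ v) (proj₁ v))
    (Distinct₃-map {f = Eᵥ v} (E-injective (VertexLift.θ≤m (vertexLift v))) (proj₁ v)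
                   (ascending⇒distinct (proj₁ (proj₂ v))))

  image-sum : (v : Vertex m g) → VertexSum n (tsum (proj₁ (image v)))
  image-sum v = class⇒vertexSum σ≤1
    (subst (λ k → InClass n σ (+ k)) (sum₃-↭₃ (↭₃-map toℕ (proj₂ (proj₂ (image v))))) (decode-sum sum≡))
    where open VertexLift (vertexLift v)

  embed : Vertex m g → Vertex n g
  embed v = proj₁ (image v) , proj₁ (proj₂ (image v)) , image-sum v

  lifts-match : ∀ {t₁ t₂ t₂′} (L₁ : VertexLift t₁) (L₂ : VertexLift t₂) → t₂ ↭₃ t₂′ →
                map₃ (E (VertexLift.θ L₁)) t₁ ≡ map₃ (E (VertexLift.θ L₂)) t₂′ → t₁ ≡ t₂′
  lifts-match {x , y , z} {_} {j , k , l} L₁ L₂ p e =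
    cong₂ _,_ (V-injective θ₁ θ₂ Vx≡Vj) (cong₂ _,_ (V-injective θ₁ θ₂ Vy≡Vk) (V-injective θ₁ θ₂ Vz≡Vl))
    where
    θ₁ = VertexLift.θ L₁
    θ₂ = VertexLift.θ L₂
    Ex≡Ej = ,-injectiveˡ e
    Ey≡Ek = ,-injectiveˡ (,-injectiveʳ e)
    Ez≡El = ,-injectiveʳ (,-injectiveʳ e)
    Vx≡Vj×Vy≡Vk : V θ₁ x ≡ V θ₂ j × V θ₁ y ≡ V θ₂ k
    Vx≡Vj×Vy≡Vk = Balanced-pair-rigid m≤n (balanced L₁ ↭₃-refl) (balanced L₂ p)
                    (decode-injective Ex≡Ej) (decode-injective Ey≡Ek)
    Vx≡Vj = proj₁ Vx≡Vj×Vy≡Vk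
    Vy≡Vk = proj₂ Vx≡Vj×Vy≡Vk
    Vz≡Vl : V θ₁ z ≡ V θ₂ l
    Vz≡Vl = Balanced-third-rigid (s≤s (s≤s z≤n)) (balanced L₁ ↭₃-refl)
              (subst₂ (λ A B → Balanced (A , B , V θ₂ l)) (sym Vx≡Vj) (sym Vy≡Vk) (balanced L₂ p))
              (decode-injective Ez≡El)

  embed-injective : ∀ v w → proj₁ (embed v) ≡ proj₁ (embed w) → proj₁ v ≡ proj₁ w
  embed-injective v w e = ascending-unique (proj₁ (proj₂ v)) (proj₁ (proj₂ w)) (↭₃-sym w↭v)
    where
    images : map₃ (Eᵥ w) (proj₁ w) ↭₃ map₃ (Eᵥ v) (proj₁ v)
    images = ↭₃-trans (proj₂ (proj₂ (image w)))
               (subst (_↭₃ map₃ (Eᵥ v) (proj₁ v)) e (↭₃-sym (proj₂ (proj₂ (image v)))))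
    unmapped = ↭₃-map⁻¹ (Eᵥ w) images
    w↭v : proj₁ w ↭₃ proj₁ v
    w↭v = subst (proj₁ w ↭₃_)
            (sym (lifts-match (vertexLift v) (vertexLift w)
                              (proj₁ (proj₂ unmapped)) (sym (proj₂ (proj₂ unmapped)))))
            (proj₁ (proj₂ unmapped))

  embed-adjacent : ∀ v w → Adj m g v w → Adj n g (embed v) (embed w)
  embed-adjacent v w adj = begin
    common (proj₁ (embed v)) (proj₁ (embed w))
      ≡⟨ common-↭₃ˡ (proj₁ (embed w)) (↭₃-sym (proj₂ (proj₂ (image v)))) ⟩
    common (map₃ E₁ (proj₁ v)) (proj₁ (embed w))
      ≡⟨ common-↭₃ʳ (map₃ E₁ (proj₁ v)) (↭₃-sym (proj₂ (proj₂ (image w)))) ⟩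
    common (map₃ E₁ (proj₁ v)) (map₃ E₂ (proj₁ w))
      ≡⟨ common-↭₃ˡ (map₃ E₂ (proj₁ w)) (↭₃-map E₁ s↭) ⟩
    common (E₁ a , E₁ b , E₁ d) (map₃ E₂ (proj₁ w))
      ≡⟨ common-↭₃ʳ (E₁ a , E₁ b , E₁ d) (↭₃-map E₂ t↭) ⟩
    common (E₁ a , E₁ b , E₁ d) (E₂ a , E₂ b , E₂ d′)
      ≡⟨ cong₂ (λ p q → common (E₁ a , E₁ b , E₁ d) (p , q , E₂ d′))
               (cong decode (sym Va≡)) (cong decode (sym Vb≡)) ⟩
    common (E₁ a , E₁ b , E₁ d) (E₁ a , E₁ b , E₂ d′)
      ≡⟨ common-two (E₁ a) (E₁ b) (E₁ d) (E₂ d′)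
                    (d≢a ∘ E-injective θ₁≤m) (d≢b ∘ E-injective θ₁≤m) Ed≢Ed′ ⟩
    2 ∎
    where
    open ≡-Reasoning
    open SharedPair (common≡2⇒SharedPair (proj₁ v) (proj₁ w) (ascending⇒distinct (proj₁ (proj₂ v))) adj)
    L₁ = vertexLift v
    L₂ = vertexLift w
    θ₁ = VertexLift.θ L₁
    θ₂ = VertexLift.θ L₂
    θ₁≤m = VertexLift.θ≤m L₁
    E₁ = E θ₁
    E₂ = E θ₂
    d≢a = proj₂ (proj₂ (Distinct₃-↭₃ s↭ (ascending⇒distinct (proj₁ (proj₂ v))))) ∘ sym
    d≢b = proj₁ (proj₂ (Distinct₃-↭₃ s↭ (ascending⇒distinct (proj₁ (proj₂ v))))) ∘ sym
    same-encoding : ∀ x → + V θ₁ x ≡ + V θ₂ x ⟨mod m ⟩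
    same-encoding x = ≡mod-trans (lift-≡mod θ₁ (encode x)) (≡mod-sym (lift-≡mod θ₂ (encode x)))
    Va≡×Vb≡ = Balanced-pair-rigid ℕ.≤-refl (balanced L₁ s↭) (balanced L₂ t↭)
                (same-encoding a) (same-encoding b)
    Va≡ = proj₁ Va≡×Vb≡
    Vb≡ = proj₂ Va≡×Vb≡
    Ed≢Ed′ : E₁ d ≢ E₂ d′
    Ed≢Ed′ Ed≡Ed′ = d≢d′ (V-injective θ₁ θ₂ (Balanced-third-rigid (s≤s (s≤s z≤n)) (balanced L₁ s↭)
      (subst₂ (λ A B → Balanced (A , B , V θ₂ d′)) (sym Va≡) (sym Vb≡) (balanced L₂ t↭))
      (decode-injective Ed≡Ed′)))

  isoToSubgraph : IsoToSubgraph m g n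
  isoToSubgraph = embed , embed-injective , embed-adjacent

lemmaA1 : (n : ℕ) → (n % 6 ≡ 1 ⊎ n % 6 ≡ 5) → 7 ≤ n → (g : ℤ) →
    IsoToSubgraph (n ∸ 6) g n
lemmaA1 n@(suc (suc (suc (suc (suc (suc m@(suc _)))))))
        n%6 (s≤s (s≤s (s≤s (s≤s (s≤s (s≤s (s≤s z≤n))))))) g =
  Embedding.isoToSubgraph m g (threeInvertible m m%6) (threeInvertible n n%6)
  where
  m%6 : m % 6 ≡ 1 ⊎ m % 6 ≡ 5
  m%6 = subst (λ r → r ≡ 1 ⊎ r ≡ 5) (trans (cong (_% 6) (ℕ.+-comm 6 m)) ([m+n]%n≡m%n m 6)) n%6
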